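{- Let $\mathcal{L}$ be a relational language, $\mathcal{M}$ and $\{\mathcal{N}_a\}_{a\in M}$ $\mathcal{L}$-structures, $\phi(v_1,\dots,v_n)$ a quantifier-free $\mathcal{L}$-formula, and $((a_1,b_1),\dots,(a_n,b_n))$ a tuple of elements of $\mathcal{M}[\mathcal{N}_a]_{a\in M}$ which is an admissible assignment for $\phi$. Then $\mathcal{M}[\mathcal{N}_a]^s_{a\in M}\models\widetilde{\phi}((a_1,b_1),\dots,(a_n,b_n))$ if and only if $\mathcal{M}\models\phi(a_1,\dots,a_n)$. In particular, if the equality symbol does not occur in $\phi$ (and the tuple is admissible for $\phi$), then $\mathcal{M}[\mathcal{N}_a]^s_{a\in M}\models\phi((a_1,b_1),\dots,(a_n,b_n))$ iff $\mathcal{M}\models\phi(a_1,\dots,a_n)$.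
   Context: Generalized product: $\mathcal{M}[\mathcal{N}_a]_{a\in M}$ has universe $\bigcup_{a\in M}\{a\}\times N_a$ and, for each $n$-ary $R\in\mathcal{L}$, $((a_1,b_1),\dots,(a_n,b_n))\in R$ iff either ($a_1=\dots=a_n=a$ and $\mathcal{N}_a\models R(b_1,\dots,b_n)$) or ($a_i\neq a_j$ for some $i,j$ and $\mathcal{M}\models R(a_1,\dots,a_n)$); $\mathcal{M}[\mathcal{N}_a]^s_{a\in M}$ is its expansion by a binary relation $s$ interpreted as $\{((a,b_1),(a,b_2)) : a\in M,\ b_1,b_2\in N_a\}$. For an $\mathcal{L}$-formula $\phi$, $\widetilde{\phi}$ denotes the $\mathcal{L}\cup\{s\}$-formula obtained from $\phi$ by replacing every atomic subformula $x=y$ by $s(x,y)$ (all other symbols unchanged). A tuple $((a_1,b_1),\dots,(a_n,b_n))$ is an admissible assignment for $\phi(v_1,\dots,v_n)$ if for every $R\in\mathcal{L}$ and every occurrence $R(v_{i_1},\dots,v_{i_k})$ in $\phi$, there are $1\le l<m\le k$ with $a_{i_l}\neq a_{i_m}$. -}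

module Defs where

open import Data.Nat using (ℕ)
open import Data.Fin using (Fin; zero; suc; _<_)
open import Data.Product using (Σ; ∃; _×_; _,_; proj₁; proj₂)
open import Data.Sum using (_⊎_; inj₁; inj₂)
open import Data.Unit using (⊤; tt)
open import Data.Empty using (⊥)
open import Relation.Nullary using (¬_)
open import Relation.Binary.PropositionalEquality using (_≡_)

-- A relational language: a set of relation symbols, each with an arity.
-- (Equality is a logical symbol, not a member of Rel.)
record Language : Set₁ where
  field
    Rel   : Set
    arity : Rel → ℕ
open Language public

record Structure (L : Language) : Set₁ where
  field
    Carrier : Set
    rel     : (R : Rel L) → (Fin (arity L R) → Carrier) → Set
open Structure public

data QF (L : Language) (n : ℕ) : Set where
  eq    : Fin n → Fin n → QF L n
  atom  : (R : Rel L) → (Fin (arity L R) → Fin n) → QF L n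
  ⊤′ ⊥′ : QF L n
  ¬′_   : QF L n → QF L n
  _∧′_ _∨′_ _⇒′_ : QF L n → QF L n → QF L n

Sat : {L : Language} {n : ℕ} (M : Structure L) → QF L n → (Fin n → Carrier M) → Set
Sat M (eq i j)   a = a i ≡ a j
Sat M (atom R is) a = rel M R (λ l → a (is l))
Sat M ⊤′         a = ⊤
Sat M ⊥′         a = ⊥
Sat M (¬′ φ)     a = ¬ Sat M φ a
Sat M (φ ∧′ ψ)   a = Sat M φ a × Sat M ψ a
Sat M (φ ∨′ ψ)   a = Sat M φ a ⊎ Sat M ψ a
Sat M (φ ⇒′ ψ)   a = Sat M φ a → Sat M ψ a

sArity : (L : Language) → Rel L ⊎ ⊤ → ℕ
sArity L (inj₁ R) = arity L R
sArity L (inj₂ _) = 2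

L+s : Language → Language
L+s L = record { Rel = Rel L ⊎ ⊤ ; arity = sArity L }

ProdCarrier : {L : Language} (M : Structure L) (N : Carrier M → Structure L) → Set
ProdCarrier M N = Σ (Carrier M) (λ a → Carrier (N a))

prodRel : {L : Language} (M : Structure L) (N : Carrier M → Structure L)
          (R : Rel L) → (Fin (arity L R) → ProdCarrier M N) → Set
prodRel {L} M N R t =
  (Σ (Carrier M) λ a → Σ (Fin (arity L R) → Carrier (N a)) λ c →
      ((i : Fin (arity L R)) → t i ≡ (a , c i)) × rel (N a) R c)
  ⊎ (Σ (Fin (arity L R)) λ i → Σ (Fin (arity L R)) λ j →
      (¬ (proj₁ (t i) ≡ proj₁ (t j))) × rel M R (λ l → proj₁ (t l)))

GenProd : {L : Language} (M : Structure L) (N : Carrier M → Structure L) → Structure L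
GenProd M N = record { Carrier = ProdCarrier M N ; rel = prodRel M N }

prodRelS : {L : Language} (M : Structure L) (N : Carrier M → Structure L)
           (R : Rel L ⊎ ⊤) → (Fin (sArity L R) → ProdCarrier M N) → Set
prodRelS M N (inj₁ R) t = prodRel M N R t
prodRelS M N (inj₂ _) t = proj₁ (t zero) ≡ proj₁ (t (suc zero))

GenProdS : {L : Language} (M : Structure L) (N : Carrier M → Structure L) → Structure (L+s L)
GenProdS M N = record { Carrier = ProdCarrier M N ; rel = prodRelS M N }

pair : {n : ℕ} → Fin n → Fin n → Fin 2 → Fin n
pair i j zero       = i
pair i j (suc zero) = j

tilde : {L : Language} {n : ℕ} → QF L n → QF (L+s L) n
tilde (eq i j)   = atom (inj₂ tt) (pair i j)
tilde (atom R is) = atom (inj₁ R) is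
tilde ⊤′         = ⊤′
tilde ⊥′         = ⊥′
tilde (¬′ φ)     = ¬′ tilde φ
tilde (φ ∧′ ψ)   = tilde φ ∧′ tilde ψ
tilde (φ ∨′ ψ)   = tilde φ ∨′ tilde ψ
tilde (φ ⇒′ ψ)   = tilde φ ⇒′ tilde ψ

lift : {L : Language} {n : ℕ} → QF L n → QF (L+s L) n
lift (eq i j)   = eq i j
lift (atom R is) = atom (inj₁ R) is
lift ⊤′         = ⊤′
lift ⊥′         = ⊥′
lift (¬′ φ)     = ¬′ lift φ
lift (φ ∧′ ψ)   = lift φ ∧′ lift ψ
lift (φ ∨′ ψ)   = lift φ ∨′ lift ψ
lift (φ ⇒′ ψ)   = lift φ ⇒′ lift ψ

NoEq : {L : Language} {n : ℕ} → QF L n → Set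
NoEq (eq i j)   = ⊥
NoEq (atom R is) = ⊤
NoEq ⊤′         = ⊤
NoEq ⊥′         = ⊤
NoEq (¬′ φ)     = NoEq φ
NoEq (φ ∧′ ψ)   = NoEq φ × NoEq ψ
NoEq (φ ∨′ ψ)   = NoEq φ × NoEq ψ
NoEq (φ ⇒′ ψ)   = NoEq φ × NoEq ψ

Admissible : {L : Language} {n : ℕ} (M : Structure L) (N : Carrier M → Structure L)
             → QF L n → (Fin n → ProdCarrier M N) → Set
Admissible M N (eq i j)   t = ⊤
Admissible {L} M N (atom R is) t =
  Σ (Fin (arity L R)) λ l → Σ (Fin (arity L R)) λ m →
    (l < m) × (¬ (proj₁ (t (is l)) ≡ proj₁ (t (is m))))
Admissible M N ⊤′         t = ⊤
Admissible M N ⊥′         t = ⊤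
Admissible M N (¬′ φ)     t = Admissible M N φ t
Admissible M N (φ ∧′ ψ)   t = Admissible M N φ t × Admissible M N ψ t
Admissible M N (φ ∨′ ψ)   t = Admissible M N φ t × Admissible M N ψ t
Admissible M N (φ ⇒′ ψ)   t = Admissible M N φ t × Admissible M N ψ t

module Submission where

-- An admissible assignment never sends an occurrence of a
-- relation symbol R to a tuple lying inside a single fibre {a} × N_a, so
-- the product interprets every such occurrence exactly as M does on the
-- first coordinates (distinct-fibres lemma below).  The symbol s relates
-- two elements precisely when their first coordinates agree, so s(x,y) in
-- the product says the same as x = y in M.  Hence, by induction on the
-- quantifier-free formula, φ̃ holds of t in M[N_a]^s iff φ holds of the
-- first coordinates of t in M (tilde-correct).  For the second claim,
-- replacing = by s does nothing to an equality-free formula, i.e.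
-- lift φ and tilde φ are the same formula (lift≡tilde), so it reduces to
-- the first.

open import Defs
open import Data.Nat using (ℕ)
open import Data.Fin using (Fin)
open import Data.Product using (_×_; _,_; proj₁)
open import Data.Product.Function.NonDependent.Propositional using (_×-⇔_)
open import Data.Sum using (inj₁; inj₂)
open import Data.Sum.Function.Propositional using (_⊎-⇔_)
open import Data.Empty using (⊥-elim)
open import Relation.Nullary using (¬_)
open import Function.Bundles using (_⇔_; mk⇔)
open import Function.Construct.Identity using (⇔-id)
open import Function.Related.TypeIsomorphisms using (¬-cong-⇔; →-cong-⇔)
open import Relation.Binary.PropositionalEquality
  using (_≡_; refl; trans; sym; cong; cong₂; subst)

-- Distinct-fibres lemma: on a tuple whose entries do not all lie in one
-- fibre, the generalized product interprets R as M does on first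
-- coordinates (the "same fibre" clause of prodRel is impossible).
prodRel-distinct : {L : Language} (M : Structure L) (N : Carrier M → Structure L)
  (R : Rel L) (u : Fin (arity L R) → ProdCarrier M N) (i j : Fin (arity L R))
  → ¬ (proj₁ (u i) ≡ proj₁ (u j))
  → prodRel M N R u ⇔ rel M R (λ l → proj₁ (u l))
prodRel-distinct M N R u i j i≢j = mk⇔ toM (λ r → inj₂ (i , j , i≢j , r))
  where
  toM : prodRel M N R u → rel M R (λ l → proj₁ (u l))
  toM (inj₁ (_ , _ , inFibre , _)) =
    ⊥-elim (i≢j (trans (cong proj₁ (inFibre i)) (sym (cong proj₁ (inFibre j)))))
  toM (inj₂ (_ , _ , _ , r)) = r

-- The eq case
-- is definitional, since s compares first coordinates.
tilde-correct : {L : Language} (M : Structure L) (N : Carrier M → Structure L)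
  {n : ℕ} (φ : QF L n) (t : Fin n → ProdCarrier M N)
  → Admissible M N φ t
  → Sat (GenProdS M N) (tilde φ) t ⇔ Sat M φ (λ i → proj₁ (t i))
tilde-correct M N (eq i j)    t _ = ⇔-id _
tilde-correct M N (atom R is) t (l , m , _ , l≢m) =
  prodRel-distinct M N R (λ k → t (is k)) l m l≢m
tilde-correct M N ⊤′          t _ = ⇔-id _
tilde-correct M N ⊥′          t _ = ⇔-id _
tilde-correct M N (¬′ φ)      t adm = ¬-cong-⇔ (tilde-correct M N φ t adm)
tilde-correct M N (φ ∧′ ψ)    t (admφ , admψ) =
  tilde-correct M N φ t admφ ×-⇔ tilde-correct M N ψ t admψ
tilde-correct M N (φ ∨′ ψ)    t (admφ , admψ) =
  tilde-correct M N φ t admφ ⊎-⇔ tilde-correct M N ψ t admψ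
tilde-correct M N (φ ⇒′ ψ)    t (admφ , admψ) =
  →-cong-⇔ (tilde-correct M N φ t admφ) (tilde-correct M N ψ t admψ)

lift≡tilde : {L : Language} {n : ℕ} (φ : QF L n) → NoEq φ → lift φ ≡ tilde φ
lift≡tilde (eq i j)    ()
lift≡tilde (atom R is) _ = refl
lift≡tilde ⊤′          _ = refl
lift≡tilde ⊥′          _ = refl
lift≡tilde (¬′ φ)      noEq = cong ¬′_ (lift≡tilde φ noEq)
lift≡tilde (φ ∧′ ψ)    (noEqφ , noEqψ) = cong₂ _∧′_ (lift≡tilde φ noEqφ) (lift≡tilde ψ noEqψ)
lift≡tilde (φ ∨′ ψ)    (noEqφ , noEqψ) = cong₂ _∨′_ (lift≡tilde φ noEqφ) (lift≡tilde ψ noEqψ)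
lift≡tilde (φ ⇒′ ψ)    (noEqφ , noEqψ) = cong₂ _⇒′_ (lift≡tilde φ noEqφ) (lift≡tilde ψ noEqψ)

lemma2p11 : (L : Language) (M : Structure L) (N : Carrier M → Structure L)
    (n : ℕ) (φ : QF L n) (t : Fin n → ProdCarrier M N)
    → Admissible M N φ t
    → (Sat (GenProdS M N) (tilde φ) t ⇔ Sat M φ (λ i → proj₁ (t i)))
    × (NoEq φ → (Sat (GenProdS M N) (lift φ) t ⇔ Sat M φ (λ i → proj₁ (t i))))
lemma2p11 L M N n φ t adm = correct , equalityFree
  where
  correct : Sat (GenProdS M N) (tilde φ) t ⇔ Sat M φ (λ i → proj₁ (t i))
  correct = tilde-correct M N φ t adm

  equalityFree : NoEq φ → Sat (GenProdS M N) (lift φ) t ⇔ Sat M φ (λ i → proj₁ (t i))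
  equalityFree noEq =
    subst (λ ψ → Sat (GenProdS M N) ψ t ⇔ Sat M φ (λ i → proj₁ (t i)))
          (sym (lift≡tilde φ noEq)) correct
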